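{- Let $r\ge 1$ and $j\ge 0$ be integers. Then $$G_{j+1}^{(r)}=\sum_{k=0}^{\lfloor j/2\rfloor}M(r,k,j-2k)\qquad\text{and}\qquad H_{j+1}^{(r)}=\sum_{k=0}^{\lfloor j/2\rfloor}V_1(r,k,j-2k).$$
   Context: For a positive integer $r$, the convolved Fibonacci numbers $F_{j+1}^{(r)}$ ($j\ge0$) are defined by $(1-z-z^2)^{ -r}=\sum_{j\ge 0}F_{j+1}^{(r)}z^j$. With $\mu$ the Möbius function, $G_{j+1}^{(r)}=\frac1r\sum_{d\mid\gcd(r,j)}\mu(d)F_{j/d+1}^{(r/d)}$ and $H_{j+1}^{(r)}=\frac{(-1)^r}{r}\sum_{d\mid\gcd(r,j)}\mu(d)(-1)^{r/d}F_{j/d+1}^{(r/d)}$ (for $j=0$, $d$ ranges over divisors of $r$); equivalently $G_{j+1}^{(r)}$ is the coefficient of $z^j$ in $\frac1r\sum_{d\mid r}\mu(d)f(z^d)^{r/d}$ with $f=1/(1-z-z^2)$, and $H_{j+1}^{(r)}$ is $(-1)^r$ times this coefficient with $f=-1/(1-z-z^2)$. For non-negative integers $n_1,\dots,n_s$ with $n=n_1+\cdots+n_s\ge1$, define $$M(n_1,\dots,n_s)=\frac1n\sum_{d\mid\gcd(n_1,\dots,n_s)}\mu(d)\frac{(n/d)!}{(n_1/d)!\cdots(n_s/d)!}$$ (the number of primitive circular words of length $n$ in which letter $x_i$ occurs $n_i$ times), and $$V_1(n_1,\dots,n_s)=\frac{(-1)^{n_1}}{n}\sum_{d\mid\gcd(n_1,\dots,n_s)}\mu(d)(-1)^{n_1/d}\frac{(n/d)!}{(n_1/d)!\cdots(n_s/d)!}.$$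 Here $\gcd$ with zero entries ignores the zeros. -}

module Defs where

open import Data.Bool using (Bool; true; false; if_then_else_; not)
open import Data.Nat as ℕ using (ℕ; zero; suc; _∸_; _!; NonZero; _≡ᵇ_)
open import Data.Nat.Properties using (_!≢0; _!*_!≢0; m*n≢0)
open import Data.Nat.Divisibility using (_∣?_)
open import Data.Nat.Primality using (prime?)
open import Data.Nat.GCD using (gcd)
open import Data.Integer as ℤ using (ℤ; +_; -_)
open import Data.Rational as ℚ using (ℚ)
open import Data.List using (List; []; _∷_; map; filter; upTo; foldr; length)
open import Data.Bool.ListAction using (any)
open import Relation.Nullary.Decidable using (does; _×-dec_)

sumℤ : List ℤ → ℤ
sumℤ = foldr ℤ._+_ (+ 0)

sumℚ : List ℚ → ℚ
sumℚ = foldr ℚ._+_ ℚ.0ℚ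

sgn : ℕ → ℤ
sgn e = (- (+ 1)) ℤ.^ e

-- Möbius function: μ(n) = 0 if p^2 ∣ n for some prime p, else (-1)^(number of prime divisors of n).
-- (Only used for n ≥ 1.)
primeDivisors : ℕ → List ℕ
primeDivisors n = filter (λ p → prime? p ×-dec p ∣? n) (upTo (suc n))

μ : ℕ → ℤ
μ n = if any (λ p → does ((p ℕ.* p) ∣? n)) (primeDivisors n)
      then + 0
      else sgn (length (primeDivisors n))

sumDiv : ℕ → ((d : ℕ) → .{{NonZero d}} → ℤ) → ℤ
sumDiv g f = sumℤ (map (λ i → f (suc i)) (filter (λ i → suc i ∣? g) (upTo g)))

fib : ℕ → ℕ
fib zero = 0
fib (suc zero) = 1
fib (suc (suc n)) = fib (suc n) ℕ.+ fib n

-- convF r j = F_{j+1}^{(r)} = coefficient of z^j in (1 - z - z^2)^(-r),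
-- computed as the r-fold Cauchy power of the series 1/(1-z-z^2) = Σ fib(j+1) z^j
convF : ℕ → ℕ → ℕ
convF zero zero = 1
convF zero (suc j) = 0
convF (suc r) j = foldr ℕ._+_ 0 (map (λ i → fib (suc i) ℕ.* convF r (j ∸ i)) (upTo (suc j)))

G : (r j : ℕ) → .{{NonZero r}} → ℚ
G r j = sumDiv (gcd r j) (λ d → μ d ℤ.* + convF (r ℕ./ d) (j ℕ./ d)) ℚ./ r

H : (r j : ℕ) → .{{NonZero r}} → ℚ
H r j = (sgn r ℤ.* sumDiv (gcd r j)
          (λ d → μ d ℤ.* sgn (r ℕ./ d) ℤ.* + convF (r ℕ./ d) (j ℕ./ d))) ℚ./ r

multinom : ℕ → ℕ → ℕ → ℕ
multinom a b c = ℕ._/_ ((a ℕ.+ b ℕ.+ c) !) (a ! ℕ.* b ! ℕ.* c !)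
  {{m*n≢0 (a ! ℕ.* b !) (c !) {{a !* b !≢0}} {{c !≢0}}}}

-- z / n as a rational (convention: value 0 when n = 0; never used here since n ≥ 1)
over : ℤ → ℕ → ℚ
over z zero = ℚ.0ℚ
over z (suc n) = z ℚ./ suc n

-- M(n1,n2,n3); the gcd of the three entries via stdlib gcd (gcd x 0 = x, so zeros are ignored)
M : ℕ → ℕ → ℕ → ℚ
M a b c = over (sumDiv (gcd (gcd a b) c)
            (λ d → μ d ℤ.* + multinom (a ℕ./ d) (b ℕ./ d) (c ℕ./ d)))
          (a ℕ.+ b ℕ.+ c)

V₁ : ℕ → ℕ → ℕ → ℚ
V₁ a b c = over (sgn a ℤ.* sumDiv (gcd (gcd a b) c)
             (λ d → μ d ℤ.* sgn (a ℕ./ d) ℤ.* + multinom (a ℕ./ d) (b ℕ./ d) (c ℕ./ d)))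
           (a ℕ.+ b ℕ.+ c)

-- Expanding (1 − z − z²)^(−s) = (1 − (z + z²))^(−s) gives F_{j+1}^{(s)} = Σ_k N(s − 1, k, j − 2k)
-- with N(a, b, c) = (a + b + c)! / (a! b! c!), and N(q − 1, k, m) / q = N(q, k, m) / (q + k + m).
-- So the summand of d in G = (1/r) Σ_d μ(d) F_{j/d+1}^{(r/d)} becomes
-- Σ_k′ μ(d) N(r/d, k′, j/d − 2k′) / (r + k′d + (j − 2k′d)), and likewise for H with signs.
-- Substituting k = k′d and exchanging the sums over d and k gives the claim, because for 2k ≤ j the
-- divisors of gcd(r, k, j − 2k) are exactly the common divisors of gcd(r, j) and k.
module Submission where

open import Algebra.Structures using (IsCommutativeMonoid)
open import Data.Bool using (true; false; if_then_else_)
open import Data.Bool.Properties using (if-swap-then)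
open import Data.List using (List; []; _∷_; [_]; _++_; map; foldr; filter; upTo; applyUpTo)
open import Data.Nat.ListAction using (sum)
open import Data.List.Properties
  using (map-++; map-cong; map-cong-local; map-upTo; map-applyUpTo; upTo-∷ʳ)
import Data.List.Relation.Unary.All as All
open import Data.List.Relation.Unary.All.Properties using (all-upTo)
open import Data.Nat
  using ( ℕ; zero; suc; pred; _+_; _*_; _∸_; _/_; _!; _≤_; _<_; _<?_; z≤n; s≤s
        ; NonZero; ≢-nonZero; ≢-nonZero⁻¹; >-nonZero)
open import Data.Nat.Properties
open import Data.Nat.Combinatorics using (k![n∸k]!∣n!)
open import Data.Nat.Divisibility
  using ( _∣_; _∣?_; ∣-trans; ∣⇒≤; *-monoʳ-∣; n∣m*n; ∣n⇒∣m*n; ∣m+n∣m⇒∣n; ∣m∸n∣n⇒∣m; 0∣⇒≡0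
        ; module ∣-Reasoning)
open import Data.Nat.DivMod
  using (m/n*n≡m; m*n/n≡m; m/n*n≤m; /-congˡ; /-monoˡ-≤; m/n≡1+[m∸n]/n; m≥n⇒m/n>0)
open import Data.Nat.GCD using (gcd; gcd[m,n]∣m; gcd[m,n]∣n; gcd-greatest)
open import Data.Integer as ℤ using (ℤ; +_)
import Data.Integer.Properties as ℤP
import Data.Integer.Tactic.RingSolver as ℤ-Solver
open import Data.Rational as ℚ using (ℚ; 0ℚ; fromℚᵘ; toℚᵘ)
import Data.Rational.Properties as ℚP
open import Data.Rational.Unnormalised as ℚᵘ using (mkℚᵘ; *≡*)
import Data.Rational.Unnormalised.Properties as ℚᵘP
open import Data.Nat.Tactic.RingSolver using (solve-∀)
open import Data.Product using (_×_; _,_; proj₁; proj₂)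
open import Function using (_∘_; _⇔_; mk⇔; Equivalence)
open import Level using (0ℓ)
open import Relation.Nullary using (Dec; does; yes; no; ¬_)
open import Relation.Nullary.Decidable using (dec-true; dec-false; does-⇔)
open import Relation.Unary using (Pred; Decidable)
open import Relation.Binary.PropositionalEquality hiding ([_]; J)

open import Defs

-- Finite sums

map-cong-upTo : ∀ {A : Set} {f g : ℕ → A} n → (∀ k → k < n → f k ≡ g k) →
  map f (upTo n) ≡ map g (upTo n)
map-cong-upTo n f≗g = map-cong-local (All.map (f≗g _) (all-upTo n))

foldr-map-homo : ∀ {A B C : Set} {_∙_ : A → A → A} {ε : A} {_◦_ : B → B → B} {ε′ : B}
  (f : A → B) → f ε ≡ ε′ → (∀ x y → f (x ∙ y) ≡ f x ◦ f y) →
  (h : C → A) (xs : List C) → f (foldr _∙_ ε (map h xs)) ≡ foldr _◦_ ε′ (map (f ∘ h) xs)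
foldr-map-homo f f-ε f-∙ h [] = f-ε
foldr-map-homo {_◦_ = _◦_} f f-ε f-∙ h (x ∷ xs) =
  trans (f-∙ (h x) _) (cong (f (h x) ◦_) (foldr-map-homo f f-ε f-∙ h xs))

module ListSum {A : Set} {_∙_ : A → A → A} {ε : A} (isCM : IsCommutativeMonoid _≡_ _∙_ ε) where
  open IsCommutativeMonoid isCM using (assoc; comm; identityˡ; identityʳ)
  open ≡-Reasoning

  Σ : List A → A
  Σ = foldr _∙_ ε

  sum-++ : ∀ xs ys → Σ (xs ++ ys) ≡ Σ xs ∙ Σ ys
  sum-++ [] ys = sym (identityˡ _)
  sum-++ (x ∷ xs) ys = trans (cong (x ∙_) (sum-++ xs ys)) (sym (assoc x _ _))

  sum-map-ε : ∀ {B : Set} (f : B → A) xs → (∀ x → f x ≡ ε) → Σ (map f xs) ≡ ε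
  sum-map-ε f [] _ = refl
  sum-map-ε f (x ∷ xs) f≡ε = trans (cong₂ _∙_ (f≡ε x) (sum-map-ε f xs f≡ε)) (identityˡ ε)

  sum-map-∙ : ∀ {B : Set} (f g : B → A) xs →
    Σ (map (λ x → f x ∙ g x) xs) ≡ Σ (map f xs) ∙ Σ (map g xs)
  sum-map-∙ f g [] = sym (identityˡ ε)
  sum-map-∙ f g (x ∷ xs) = begin
    (f x ∙ g x) ∙ Σ (map (λ y → f y ∙ g y) xs) ≡⟨ cong ((f x ∙ g x) ∙_) (sum-map-∙ f g xs) ⟩
    (f x ∙ g x) ∙ (Sf ∙ Sg)                     ≡⟨ assoc (f x) (g x) (Sf ∙ Sg) ⟩
    f x ∙ (g x ∙ (Sf ∙ Sg))                     ≡⟨ cong (f x ∙_) (assoc (g x) Sf Sg) ⟨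
    f x ∙ ((g x ∙ Sf) ∙ Sg)                     ≡⟨ cong (λ y → f x ∙ (y ∙ Sg)) (comm (g x) Sf) ⟩
    f x ∙ ((Sf ∙ g x) ∙ Sg)                     ≡⟨ cong (f x ∙_) (assoc Sf (g x) Sg) ⟩
    f x ∙ (Sf ∙ (g x ∙ Sg))                     ≡⟨ assoc (f x) Sf (g x ∙ Sg) ⟨
    (f x ∙ Sf) ∙ (g x ∙ Sg)                     ∎
    where
    Sf = Σ (map f xs)
    Sg = Σ (map g xs)

  sum-swap : ∀ {B C : Set} (f : B → C → A) xs ys →
    Σ (map (λ x → Σ (map (f x) ys)) xs) ≡ Σ (map (λ y → Σ (map (λ x → f x y) xs)) ys)
  sum-swap f [] ys = sym (sum-map-ε _ ys (λ _ → refl))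
  sum-swap f (x ∷ xs) ys =
    trans (cong (Σ (map (f x) ys) ∙_) (sum-swap f xs ys)) (sym (sum-map-∙ (f x) _ ys))

  sum-map-filter : ∀ {B : Set} {P : Pred B 0ℓ} (P? : Decidable P) (f : B → A) xs →
    Σ (map f (filter P? xs)) ≡ Σ (map (λ x → if does (P? x) then f x else ε) xs)
  sum-map-filter P? f [] = refl
  sum-map-filter P? f (x ∷ xs) with does (P? x)
  ... | true  = cong (f x ∙_) (sum-map-filter P? f xs)
  ... | false = trans (sum-map-filter P? f xs) (sym (identityˡ _))

  sum-upTo-ε : ∀ (f : ℕ → A) n → (∀ k → k < n → f k ≡ ε) → Σ (map f (upTo n)) ≡ ε
  sum-upTo-ε f n f≡ε = trans (cong Σ (map-cong-upTo n f≡ε)) (sum-map-ε _ (upTo n) (λ _ → refl))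

  sum-upTo-head : ∀ (f : ℕ → A) n →
    Σ (map f (upTo (suc n))) ≡ f 0 ∙ Σ (map (f ∘ suc) (upTo n))
  sum-upTo-head f n =
    cong (λ xs → f 0 ∙ Σ xs) (trans (map-applyUpTo suc f n) (sym (map-upTo (f ∘ suc) n)))

  sum-upTo-last : ∀ (f : ℕ → A) n → Σ (map f (upTo (suc n))) ≡ Σ (map f (upTo n)) ∙ f n
  sum-upTo-last f n = begin
    Σ (map f (upTo (suc n)))        ≡⟨ cong (Σ ∘ map f) (upTo-∷ʳ n) ⟨
    Σ (map f (upTo n ++ [ n ]))     ≡⟨ cong Σ (map-++ f (upTo n) [ n ]) ⟩
    Σ (map f (upTo n) ++ [ f n ])   ≡⟨ sum-++ (map f (upTo n)) [ f n ] ⟩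
    Σ (map f (upTo n)) ∙ (f n ∙ ε)  ≡⟨ cong (Σ (map f (upTo n)) ∙_) (identityʳ (f n)) ⟩
    Σ (map f (upTo n)) ∙ f n        ∎

  sum-upTo-+ : ∀ (f : ℕ → A) m n →
    Σ (map f (upTo (m + n))) ≡ Σ (map f (upTo m)) ∙ Σ (map (λ k → f (m + k)) (upTo n))
  sum-upTo-+ f m zero = trans (cong (Σ ∘ map f ∘ upTo) (+-identityʳ m)) (sym (identityʳ _))
  sum-upTo-+ f m (suc n) = begin
    Σ (map f (upTo (m + suc n)))    ≡⟨ cong (Σ ∘ map f ∘ upTo) (+-suc m n) ⟩
    Σ (map f (upTo (suc (m + n))))  ≡⟨ sum-upTo-last f (m + n) ⟩
    Σ (map f (upTo (m + n))) ∙ f (m + n) ≡⟨ cong (_∙ f (m + n)) (sum-upTo-+ f m n) ⟩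
    (S ∙ T) ∙ f (m + n)             ≡⟨ assoc S T (f (m + n)) ⟩
    S ∙ (T ∙ f (m + n))             ≡⟨ cong (S ∙_) (sum-upTo-last (λ k → f (m + k)) n) ⟨
    S ∙ Σ (map (λ k → f (m + k)) (upTo (suc n))) ∎
    where
    S = Σ (map f (upTo m))
    T = Σ (map (λ k → f (m + k)) (upTo n))

  sum-upTo-truncate : ∀ (f : ℕ → A) {m n} → m ≤ n → (∀ k → m ≤ k → f k ≡ ε) →
    Σ (map f (upTo n)) ≡ Σ (map f (upTo m))
  sum-upTo-truncate f {m} {n} m≤n f≡ε = begin
    Σ (map f (upTo n))                ≡⟨ cong (Σ ∘ map f ∘ upTo) (m+[n∸m]≡n m≤n) ⟨
    Σ (map f (upTo (m + (n ∸ m))))    ≡⟨ sum-upTo-+ f m (n ∸ m) ⟩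
    S ∙ Σ (map (λ k → f (m + k)) (upTo (n ∸ m)))
      ≡⟨ cong (S ∙_) (sum-map-ε _ (upTo (n ∸ m)) (λ k → f≡ε (m + k) (m≤m+n m k))) ⟩
    S ∙ ε                             ≡⟨ identityʳ S ⟩
    S                                 ∎
    where S = Σ (map f (upTo m))

  sum-upTo-if-< : ∀ (f : ℕ → A) {m n} → m ≤ n →
    Σ (map (λ k → if does (k <? m) then f k else ε) (upTo n)) ≡ Σ (map f (upTo m))
  sum-upTo-if-< f {m} m≤n = trans
    (sum-upTo-truncate _ m≤n (λ k m≤k → cong (λ b → if b then f k else ε)
      (dec-false (k <? m) (≤⇒≯ m≤k))))
    (cong Σ (map-cong-upTo m (λ k k<m → cong (λ b → if b then f k else ε)
      (dec-true (k <? m) k<m))))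

  sum-upTo-multiples : ∀ d .{{_ : NonZero d}} (f : ℕ → A) n →
    Σ (map (λ k → if does (d ∣? k) then f k else ε) (upTo (n * d)))
      ≡ Σ (map (λ k → f (k * d)) (upTo n))
  sum-upTo-multiples d f zero = refl
  sum-upTo-multiples d@(suc i) f (suc n) = begin
    Σ (map g (upTo (d + n * d)))   ≡⟨ cong (Σ ∘ map g ∘ upTo) (+-comm d (n * d)) ⟩
    Σ (map g (upTo (n * d + d)))   ≡⟨ sum-upTo-+ g (n * d) d ⟩
    Σ (map g (upTo (n * d))) ∙ Σ (map (λ t → g (n * d + t)) (upTo d))
      ≡⟨ cong₂ _∙_ (sum-upTo-multiples d f n) last-block ⟩
    Σ (map (λ k → f (k * d)) (upTo n)) ∙ f (n * d) ≡⟨ sum-upTo-last (λ k → f (k * d)) n ⟨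
    Σ (map (λ k → f (k * d)) (upTo (suc n))) ∎
    where
    g : ℕ → A
    g k = if does (d ∣? k) then f k else ε
    d∣nd+0 : d ∣ n * d + 0
    d∣nd+0 = subst (d ∣_) (sym (+-identityʳ (n * d))) (n∣m*n n)
    d∤ : ∀ t → t < i → ¬ d ∣ n * d + suc t
    d∤ t t<i d∣ = <⇒≱ (s≤s t<i) (∣⇒≤ (∣m+n∣m⇒∣n d∣ (n∣m*n n)))
    last-block : Σ (map (λ t → g (n * d + t)) (upTo d)) ≡ f (n * d)
    last-block = begin
      Σ (map (λ t → g (n * d + t)) (upTo (suc i)))
        ≡⟨ sum-upTo-head _ i ⟩
      g (n * d + 0) ∙ Σ (map (λ t → g (n * d + suc t)) (upTo i))
        ≡⟨ cong₂ _∙_ (cong (λ b → if b then f (n * d + 0) else ε) (dec-true (d ∣? _) d∣nd+0))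
                     (sum-upTo-ε _ i (λ t t<i → cong (λ b → if b then f (n * d + suc t) else ε)
                                                      (dec-false (d ∣? _) (d∤ t t<i)))) ⟩
      f (n * d + 0) ∙ ε
        ≡⟨ trans (identityʳ _) (cong f (+-identityʳ (n * d))) ⟩
      f (n * d) ∎

  sum-upTo-divisible : ∀ d .{{_ : NonZero d}} (f : ℕ → A) {m n} → (∀ k → k * d < m ⇔ k < n) →
    Σ (map (λ k → if does (d ∣? k) then f k else ε) (upTo m)) ≡ Σ (map (λ k → f (k * d)) (upTo n))
  sum-upTo-divisible d f {m} {n} k*d<m⇔k<n = begin
    Σ (map (λ k → if does (d ∣? k) then f k else ε) (upTo m))
      ≡⟨ sum-upTo-if-< _ (m≤m*n m d) ⟨
    Σ (map (λ k → if does (k <? m) then (if does (d ∣? k) then f k else ε) else ε) (upTo (m * d)))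
      ≡⟨ cong Σ (map-cong (λ k → if-swap-then (does (k <? m)) (does (d ∣? k))) (upTo (m * d))) ⟩
    Σ (map (λ k → if does (d ∣? k) then (if does (k <? m) then f k else ε) else ε) (upTo (m * d)))
      ≡⟨ sum-upTo-multiples d _ m ⟩
    Σ (map (λ k → if does (k * d <? m) then f (k * d) else ε) (upTo m))
      ≡⟨ cong Σ (map-cong (λ k → cong (λ b → if b then f (k * d) else ε)
                   (does-⇔ (k*d<m⇔k<n k) (k * d <? m) (k <? n))) (upTo m)) ⟩
    Σ (map (λ k → if does (k <? n) then f (k * d) else ε) (upTo m))
      ≡⟨ sum-upTo-if-< _ n≤m ⟩
    Σ (map (λ k → f (k * d)) (upTo n)) ∎
    where
    n≤m : n ≤ m
    n≤m = ≮⇒≥ (λ m<n → <⇒≱ (Equivalence.from (k*d<m⇔k<n m) m<n) (m≤m*n m d))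

module ℕSum = ListSum +-0-isCommutativeMonoid

-- Multinomial coefficients and the expansion of (1 − z − z²)^(−t)

factorials∣factorial : ∀ a b c → a ! * b ! * c ! ∣ (a + b + c) !
factorials∣factorial a b c = begin
  a ! * b ! * c !     ≡⟨ *-assoc (a !) (b !) (c !) ⟩
  a ! * (b ! * c !)   ∣⟨ *-monoʳ-∣ (a !) (binomial∣ b c) ⟩
  a ! * (b + c) !     ∣⟨ binomial∣ a (b + c) ⟩
  (a + (b + c)) !     ≡⟨ cong _! (+-assoc a b c) ⟨
  (a + b + c) !       ∎
  where
  open ∣-Reasoning
  binomial∣ : ∀ m n → m ! * n ! ∣ (m + n) !
  binomial∣ m n = subst (λ x → m ! * x ! ∣ (m + n) !) (m+n∸m≡n m n) (k![n∸k]!∣n! (m≤m+n m n))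

factorials≢0 : ∀ a b c → NonZero (a ! * b ! * c !)
factorials≢0 a b c = m*n≢0 (a ! * b !) (c !) {{a !* b !≢0}} {{c !≢0}}

multinom-spec : ∀ a b c → multinom a b c * (a ! * b ! * c !) ≡ (a + b + c) !
multinom-spec a b c = m/n*n≡m {{factorials≢0 a b c}} (factorials∣factorial a b c)

multinom-step : ∀ {a b c a′ b′ c′} x → a′ ! * b′ ! * c′ ! ≡ x * (a ! * b ! * c !) →
  a′ + b′ + c′ ≡ suc (a + b + c) → multinom a′ b′ c′ * x ≡ (a′ + b′ + c′) * multinom a b c
multinom-step {a} {b} {c} {a′} {b′} {c′} x factorials′ sizes′ =
  *-cancelʳ-≡ _ _ D {{factorials≢0 a b c}} (begin
    multinom a′ b′ c′ * x * D                ≡⟨ *-assoc (multinom a′ b′ c′) x D ⟩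
    multinom a′ b′ c′ * (x * D)              ≡⟨ cong (multinom a′ b′ c′ *_) factorials′ ⟨
    multinom a′ b′ c′ * (a′ ! * b′ ! * c′ !) ≡⟨ multinom-spec a′ b′ c′ ⟩
    (a′ + b′ + c′) !                         ≡⟨ cong _! sizes′ ⟩
    suc (a + b + c) * (a + b + c) !          ≡⟨ cong₂ _*_ sizes′ (multinom-spec a b c) ⟨
    (a′ + b′ + c′) * (multinom a b c * D)    ≡⟨ *-assoc (a′ + b′ + c′) (multinom a b c) D ⟨
    (a′ + b′ + c′) * multinom a b c * D      ∎)
  where
  open ≡-Reasoning
  D = a ! * b ! * c !

multinom-suc₁ : ∀ a b c → multinom (suc a) b c * suc a ≡ (suc a + b + c) * multinom a b c
multinom-suc₁ a b c =
  multinom-step {a} {b} {c} {suc a} {b} {c} (suc a) (reassoc (suc a) (a !) (b !) (c !)) refl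
  where
  reassoc : ∀ x y z u → x * y * z * u ≡ x * (y * z * u)
  reassoc = solve-∀

multinom-suc₂ : ∀ a b c → multinom a (suc b) c * suc b ≡ (a + suc b + c) * multinom a b c
multinom-suc₂ a b c = multinom-step {a} {b} {c} {a} {suc b} {c} (suc b)
  (reassoc (suc b) (a !) (b !) (c !)) (cong (_+ c) (+-suc a b))
  where
  reassoc : ∀ x y z u → y * (x * z) * u ≡ x * (y * z * u)
  reassoc = solve-∀

multinom-suc₃ : ∀ a b c → multinom a b (suc c) * suc c ≡ (a + b + suc c) * multinom a b c
multinom-suc₃ a b c = multinom-step {a} {b} {c} {a} {b} {suc c} (suc c)
  (reassoc (suc c) (a !) (b !) (c !)) (+-suc (a + b) c)
  where
  reassoc : ∀ x y z u → y * z * (x * u) ≡ x * (y * z * u)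
  reassoc = solve-∀

multinom-pred₁ : ∀ a b c .{{_ : NonZero a}} →
  multinom a b c * a ≡ (a + b + c) * multinom (pred a) b c
multinom-pred₁ (suc a) b c = multinom-suc₁ a b c

lower : (ℕ → ℕ) → ℕ → ℕ
lower f zero = 0
lower f (suc n) = f n

multinom-pascal : ∀ a b c → (a + b + c) * multinom a b c ≡
  (a + b + c) * (lower (λ x → multinom x b c) a + lower (λ y → multinom a y c) b + lower (multinom a b) c)
multinom-pascal a b c = begin
  s * N                       ≡⟨ *-distribʳ-+ N (a + b) c ⟩
  (a + b) * N + c * N         ≡⟨ cong (_+ c * N) (*-distribʳ-+ N a b) ⟩
  a * N + b * N + c * N       ≡⟨ cong₂ _+_ (cong₂ _+_ (weight₁ a) (weight₂ b)) (weight₃ c) ⟩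
  s * L₁ + s * L₂ + s * L₃    ≡⟨ cong (_+ s * L₃) (*-distribˡ-+ s L₁ L₂) ⟨
  s * (L₁ + L₂) + s * L₃      ≡⟨ *-distribˡ-+ s (L₁ + L₂) L₃ ⟨
  s * (L₁ + L₂ + L₃)          ∎
  where
  open ≡-Reasoning
  s = a + b + c
  N = multinom a b c
  L₁ = lower (λ x → multinom x b c) a
  L₂ = lower (λ y → multinom a y c) b
  L₃ = lower (multinom a b) c
  weight₁ : ∀ a → a * multinom a b c ≡ (a + b + c) * lower (λ x → multinom x b c) a
  weight₁ zero = sym (*-zeroʳ (b + c))
  weight₁ (suc a) = trans (*-comm (suc a) _) (multinom-suc₁ a b c)
  weight₂ : ∀ b → b * multinom a b c ≡ (a + b + c) * lower (λ y → multinom a y c) b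
  weight₂ zero = sym (*-zeroʳ (a + 0 + c))
  weight₂ (suc b) = trans (*-comm (suc b) _) (multinom-suc₂ a b c)
  weight₃ : ∀ c → c * multinom a b c ≡ (a + b + c) * lower (multinom a b) c
  weight₃ zero = sym (*-zeroʳ (a + b + 0))
  weight₃ (suc c) = trans (*-comm (suc c) _) (multinom-suc₃ a b c)

-- The coefficient of u^b v^c in (1 − u − v)^(−t).
negPowCoeff : ℕ → ℕ → ℕ → ℕ
negPowCoeff zero zero zero = 1
negPowCoeff zero zero (suc c) = 0
negPowCoeff zero (suc b) c = 0
negPowCoeff (suc t) b c = multinom t b c

-- Coefficientwise form of (1 − u − v)^(−(t+1)) · (1 − u − v) = (1 − u − v)^(−t).
negPowCoeff-rec : ∀ t b c → negPowCoeff (suc t) b c ≡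
  negPowCoeff t b c + lower (λ y → negPowCoeff (suc t) y c) b + lower (negPowCoeff (suc t) b) c
negPowCoeff-rec (suc t) b c = *-cancelˡ-≡ _ _ (suc t + b + c) (multinom-pascal (suc t) b c)
negPowCoeff-rec zero zero zero = refl
negPowCoeff-rec zero (suc b) c = *-cancelˡ-≡ _ _ (suc b + c) (multinom-pascal 0 (suc b) c)
negPowCoeff-rec zero zero (suc c) = *-cancelˡ-≡ _ _ (suc c) (multinom-pascal 0 0 (suc c))

-- diagonal f j = Σ_{2b + c = j} f b c
diagonal : (ℕ → ℕ → ℕ) → ℕ → ℕ
diagonal f zero = f 0 0
diagonal f (suc zero) = f 0 1
diagonal f (suc (suc j)) = f 0 (suc (suc j)) + diagonal (f ∘ suc) j

diagonal-cong : ∀ {f g} → (∀ b c → f b c ≡ g b c) → ∀ j → diagonal f j ≡ diagonal g j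
diagonal-cong f≡g zero = f≡g 0 0
diagonal-cong f≡g (suc zero) = f≡g 0 1
diagonal-cong f≡g (suc (suc j)) = cong₂ _+_ (f≡g 0 (suc (suc j))) (diagonal-cong (f≡g ∘ suc) j)

diagonal-+ : ∀ f g j → diagonal (λ b c → f b c + g b c) j ≡ diagonal f j + diagonal g j
diagonal-+ f g zero = refl
diagonal-+ f g (suc zero) = refl
diagonal-+ f g (suc (suc j)) =
  trans (cong (_+_ (f 0 (suc (suc j)) + g 0 (suc (suc j)))) (diagonal-+ (f ∘ suc) (g ∘ suc) j))
        (interchange (f 0 (suc (suc j))) (g 0 (suc (suc j))) _ _)
  where
  interchange : ∀ x y z u → x + y + (z + u) ≡ x + z + (y + u)
  interchange = solve-∀

diagonal-zero : ∀ j → diagonal (λ _ _ → 0) j ≡ 0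
diagonal-zero zero = refl
diagonal-zero (suc zero) = refl
diagonal-zero (suc (suc j)) = diagonal-zero j

diagonal-lower : ∀ f j → diagonal (λ b → lower (f b)) (suc j) ≡ diagonal f j
diagonal-lower f zero = refl
diagonal-lower f (suc zero) = +-identityʳ (f 0 1)
diagonal-lower f (suc (suc j)) = cong (_+_ (f 0 (suc (suc j)))) (diagonal-lower (f ∘ suc) j)

diagonal-upTo : ∀ f j → sum (map (λ k → f k (j ∸ 2 * k)) (upTo (suc (j / 2)))) ≡ diagonal f j
diagonal-upTo f zero = +-identityʳ (f 0 0)
diagonal-upTo f (suc zero) = +-identityʳ (f 0 1)
diagonal-upTo f (suc (suc j)) = begin
  sum (map F (upTo (suc (suc (suc j) / 2))))
    ≡⟨ cong (λ n → sum (map F (upTo (suc n)))) (m/n≡1+[m∸n]/n {suc (suc j)} {2} (s≤s (s≤s z≤n))) ⟩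
  sum (map F (upTo (suc (suc (j / 2)))))
    ≡⟨ ℕSum.sum-upTo-head F (suc (j / 2)) ⟩
  F 0 + sum (map (F ∘ suc) (upTo (suc (j / 2))))
    ≡⟨ cong (λ xs → F 0 + sum xs)
            (map-cong (λ k → cong (λ x → f (suc k) (suc (suc j) ∸ x)) (*-suc 2 k)) (upTo (suc (j / 2)))) ⟩
  f 0 (suc (suc j)) + sum (map (λ k → f (suc k) (j ∸ 2 * k)) (upTo (suc (j / 2))))
    ≡⟨ cong (_+_ (f 0 (suc (suc j)))) (diagonal-upTo (f ∘ suc) j) ⟩
  diagonal f (suc (suc j)) ∎
  where
  open ≡-Reasoning
  F : ℕ → ℕ
  F k = f k (suc (suc j) ∸ 2 * k)

-- Satisfied by X t j = [z^j] (1 − z − z²)^(−t) X₀(z), because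
-- (1 − z − z²)^(−t−1) = (1 − z − z²)^(−t) + (z + z²) (1 − z − z²)^(−t−1).
record ConvolutionRecurrence (X : ℕ → ℕ → ℕ) : Set where
  field
    rec₀ : ∀ t → X (suc t) 0 ≡ X t 0
    rec₁ : ∀ t → X (suc t) 1 ≡ X t 1 + X (suc t) 0
    rec₂ : ∀ t j → X (suc t) (suc (suc j)) ≡ X t (suc (suc j)) + X (suc t) j + X (suc t) (suc j)

open ConvolutionRecurrence

recurrence-unique : ∀ {X Y} → ConvolutionRecurrence X → ConvolutionRecurrence Y →
  (∀ j → X 0 j ≡ Y 0 j) → ∀ t j → X t j ≡ Y t j
recurrence-unique RX RY X₀≡Y₀ zero = X₀≡Y₀
recurrence-unique {X} {Y} RX RY X₀≡Y₀ (suc t) j = proj₁ (consecutive j)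
  where
  Xₜ≡Yₜ = recurrence-unique RX RY X₀≡Y₀ t
  consecutive : ∀ j → X (suc t) j ≡ Y (suc t) j × X (suc t) (suc j) ≡ Y (suc t) (suc j)
  consecutive zero = e₀ , trans (rec₁ RX t) (trans (cong₂ _+_ (Xₜ≡Yₜ 1) e₀) (sym (rec₁ RY t)))
    where e₀ = trans (rec₀ RX t) (trans (Xₜ≡Yₜ 0) (sym (rec₀ RY t)))
  consecutive (suc j) with consecutive j
  ... | e , e′ = e′ , trans (rec₂ RX t j)
                        (trans (cong₂ _+_ (cong₂ _+_ (Xₜ≡Yₜ (suc (suc j))) e) e′) (sym (rec₂ RY t j)))

diagonal-negPowCoeff-rec : ConvolutionRecurrence (diagonal ∘ negPowCoeff)
diagonal-negPowCoeff-rec = record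
  { rec₀ = λ t → trans (split t 0) (trans (+-identityʳ _) (+-identityʳ _))
  ; rec₁ = λ t → trans (split t 1) (cong (_+ diagonal (negPowCoeff (suc t)) 0) (+-identityʳ _))
  ; rec₂ = λ t j → trans (split t (suc (suc j)))
                     (cong (_+_ (diagonal (negPowCoeff t) (suc (suc j)) + diagonal (negPowCoeff (suc t)) j))
                        (diagonal-lower (negPowCoeff (suc t)) (suc j)))
  }
  where
  split : ∀ t j → diagonal (negPowCoeff (suc t)) j ≡ diagonal (negPowCoeff t) j
    + diagonal (λ b c → lower (λ y → negPowCoeff (suc t) y c) b) j
    + diagonal (λ b → lower (negPowCoeff (suc t) b)) j
  split t j = trans (diagonal-cong (negPowCoeff-rec t) j)
    (trans (diagonal-+ (λ b c → negPowCoeff t b c + lower (λ y → negPowCoeff (suc t) y c) b) _ j)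
           (cong (_+ diagonal (λ b → lower (negPowCoeff (suc t) b)) j)
             (diagonal-+ (negPowCoeff t) (λ b c → lower (λ y → negPowCoeff (suc t) y c) b) j)))

fibConv : (ℕ → ℕ) → ℕ → ℕ
fibConv c j = sum (applyUpTo (λ i → fib (suc i) * c (j ∸ i)) (suc j))

fibConv-rec : ∀ c j → fibConv c (suc (suc j)) ≡ c (suc (suc j)) + fibConv c j + fibConv c (suc j)
fibConv-rec c j = begin
  1 * c (suc (suc j)) + (1 * c (suc j) + sum (applyUpTo (λ i → fib (3 + i) * c (j ∸ i)) (suc j)))
    ≡⟨ cong (λ z → 1 * c (suc (suc j)) + (1 * c (suc j) + z)) fib-split ⟩
  1 * c (suc (suc j)) + (1 * c (suc j) + (S + fibConv c j))
    ≡⟨ rearrange (c (suc (suc j))) (c (suc j)) S (fibConv c j) ⟩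
  c (suc (suc j)) + fibConv c j + (1 * c (suc j) + S) ∎
  where
  open ≡-Reasoning
  S = sum (applyUpTo (λ i → fib (2 + i) * c (j ∸ i)) (suc j))
  sum-applyUpTo-+ : ∀ h f g n → (∀ i → h i ≡ f i + g i) →
    sum (applyUpTo h n) ≡ sum (applyUpTo f n) + sum (applyUpTo g n)
  sum-applyUpTo-+ h f g n h≡f+g = begin
    sum (applyUpTo h n)                          ≡⟨ cong sum (map-upTo h n) ⟨
    sum (map h (upTo n))                         ≡⟨ cong sum (map-cong h≡f+g (upTo n)) ⟩
    sum (map (λ i → f i + g i) (upTo n))         ≡⟨ ℕSum.sum-map-∙ f g (upTo n) ⟩
    sum (map f (upTo n)) + sum (map g (upTo n))
      ≡⟨ cong₂ _+_ (cong sum (map-upTo f n)) (cong sum (map-upTo g n)) ⟩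
    sum (applyUpTo f n) + sum (applyUpTo g n)    ∎
  fib-split : sum (applyUpTo (λ i → fib (3 + i) * c (j ∸ i)) (suc j)) ≡ S + fibConv c j
  fib-split = sum-applyUpTo-+ _ (λ i → fib (2 + i) * c (j ∸ i)) (λ i → fib (suc i) * c (j ∸ i))
    (suc j) (λ i → *-distribʳ-+ (c (j ∸ i)) (fib (2 + i)) (fib (suc i)))
  rearrange : ∀ x y z u → 1 * x + (1 * y + (z + u)) ≡ x + u + (1 * y + z)
  rearrange = solve-∀

convF-fibConv : ∀ t j → convF (suc t) j ≡ fibConv (convF t) j
convF-fibConv t j = cong sum (map-upTo (λ i → fib (suc i) * convF t (j ∸ i)) (suc j))

convF-rec : ConvolutionRecurrence convF
convF-rec = record
  { rec₀ = λ t → trans (+-identityʳ _) (+-identityʳ _)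
  ; rec₁ = λ t → cong (_+ convF (suc t) 0) (*-identityˡ (convF t 1))
  ; rec₂ = λ t j → begin
      convF (suc t) (suc (suc j))     ≡⟨ convF-fibConv t (suc (suc j)) ⟩
      fibConv (convF t) (suc (suc j)) ≡⟨ fibConv-rec (convF t) j ⟩
      convF t (suc (suc j)) + fibConv (convF t) j + fibConv (convF t) (suc j)
        ≡⟨ cong₂ (λ x y → convF t (suc (suc j)) + x + y)
                 (convF-fibConv t j) (convF-fibConv t (suc j)) ⟨
      convF t (suc (suc j)) + convF (suc t) j + convF (suc t) (suc j) ∎
  }
  where open ≡-Reasoning

convF-multinom : ∀ t .{{_ : NonZero t}} j →
  convF t j ≡ sum (map (λ k → multinom (pred t) k (j ∸ 2 * k)) (upTo (suc (j / 2))))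
convF-multinom (suc t) j = trans (recurrence-unique convF-rec diagonal-negPowCoeff-rec convF₀ (suc t) j)
                                 (sym (diagonal-upTo (multinom t) j))
  where
  convF₀ : ∀ j → convF 0 j ≡ diagonal (negPowCoeff 0) j
  convF₀ zero = refl
  convF₀ (suc zero) = refl
  convF₀ (suc (suc j)) = sym (diagonal-zero j)

-- Fractions and the divisor sums

/-distribʳ-+ : ∀ (p q : ℤ) n .{{_ : NonZero n}} → (p ℤ.+ q) ℚ./ n ≡ p ℚ./ n ℚ.+ q ℚ./ n
/-distribʳ-+ p q n@(suc n-1) = sym (begin
  fromℚᵘ p′ ℚ.+ fromℚᵘ q′
    ≡⟨ ℚP.fromℚᵘ-toℚᵘ (fromℚᵘ p′ ℚ.+ fromℚᵘ q′) ⟨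
  fromℚᵘ (toℚᵘ (fromℚᵘ p′ ℚ.+ fromℚᵘ q′))
    ≡⟨ ℚP.fromℚᵘ-cong (ℚᵘP.≃-trans (ℚP.toℚᵘ-homo-+ (fromℚᵘ p′) (fromℚᵘ q′))
                                    (ℚᵘP.+-cong (ℚP.toℚᵘ-fromℚᵘ p′) (ℚP.toℚᵘ-fromℚᵘ q′))) ⟩
  fromℚᵘ (p′ ℚᵘ.+ q′)
    ≡⟨ ℚP.fromℚᵘ-cong {p′ ℚᵘ.+ q′} {mkℚᵘ (p ℤ.+ q) n-1}
         (*≡* (trans (common-denominator p q (+ n)) (cong ((p ℤ.+ q) ℤ.*_) (sym (ℤP.pos-* n n))))) ⟩
  (p ℤ.+ q) ℚ./ n ∎)
  where
  open ≡-Reasoning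
  p′ = mkℚᵘ p n-1
  q′ = mkℚᵘ q n-1
  common-denominator : ∀ x y z → (x ℤ.* z ℤ.+ y ℤ.* z) ℤ.* z ≡ (x ℤ.+ y) ℤ.* (z ℤ.* z)
  common-denominator = ℤ-Solver.solve-∀

/-cross : ∀ (p q : ℤ) m n .{{_ : NonZero m}} .{{_ : NonZero n}} →
  p ℤ.* + n ≡ q ℤ.* + m → p ℚ./ m ≡ q ℚ./ n
/-cross p q (suc m) (suc n) eq = ℚP.fromℚᵘ-cong {mkℚᵘ p m} {mkℚᵘ q n} (*≡* eq)

/-scale : ∀ (x : ℤ) a b m n .{{_ : NonZero m}} .{{_ : NonZero n}} →
  a * n ≡ b * m → (x ℤ.* + a) ℚ./ m ≡ (x ℤ.* + b) ℚ./ n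
/-scale x a b m n an≡bm = /-cross (x ℤ.* + a) (x ℤ.* + b) m n (begin
  x ℤ.* + a ℤ.* + n   ≡⟨ ℤP.*-assoc x (+ a) (+ n) ⟩
  x ℤ.* (+ a ℤ.* + n) ≡⟨ cong (x ℤ.*_) (ℤP.pos-* a n) ⟨
  x ℤ.* + (a * n)     ≡⟨ cong (λ z → x ℤ.* + z) an≡bm ⟩
  x ℤ.* + (b * m)     ≡⟨ cong (x ℤ.*_) (ℤP.pos-* b m) ⟩
  x ℤ.* (+ b ℤ.* + m) ≡⟨ ℤP.*-assoc x (+ b) (+ m) ⟨
  x ℤ.* + b ℤ.* + m   ∎)
  where open ≡-Reasoning

module ℚSum = ListSum ℚP.+-0-isCommutativeMonoid

*-sum-/ : ∀ {B : Set} (c : ℤ) n .{{_ : NonZero n}} (h : B → ℤ) xs →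
  (c ℤ.* sumℤ (map h xs)) ℚ./ n ≡ sumℚ (map (λ x → (c ℤ.* h x) ℚ./ n) xs)
*-sum-/ c n = foldr-map-homo (λ z → (c ℤ.* z) ℚ./ n)
  (trans (cong (λ z → z ℚ./ n) (ℤP.*-zeroʳ c)) (ℚP.0/n≡0 n))
  (λ x y → trans (cong (λ z → z ℚ./ n) (ℤP.*-distribˡ-+ c x y))
                 (/-distribʳ-+ (c ℤ.* x) (c ℤ.* y) n))

*-pos-sum : ∀ {B : Set} (w : ℤ) (h : B → ℕ) xs →
  w ℤ.* + sum (map h xs) ≡ sumℤ (map (λ x → w ℤ.* + h x) xs)
*-pos-sum w = foldr-map-homo (λ n → w ℤ.* + n) (ℤP.*-zeroʳ w)
  (λ x y → trans (cong (w ℤ.*_) (ℤP.pos-+ x y)) (ℤP.*-distribˡ-+ w (+ x) (+ y)))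

sumDiv-/ : ∀ (c : ℤ) {g} B n .{{_ : NonZero B}} .{{_ : NonZero n}}
  (f : (d : ℕ) → .{{NonZero d}} → ℤ) → g ∣ B → (c ℤ.* sumDiv g f) ℚ./ n ≡
  sumℚ (map (λ i → if does (suc i ∣? g) then (c ℤ.* f (suc i)) ℚ./ n else 0ℚ) (upTo B))
sumDiv-/ c {g} B n f g∣B = begin
  (c ℤ.* sumℤ (map (λ i → f (suc i)) (filter (λ i → suc i ∣? g) (upTo g)))) ℚ./ n
    ≡⟨ *-sum-/ c n (λ i → f (suc i)) (filter (λ i → suc i ∣? g) (upTo g)) ⟩
  sumℚ (map (λ i → (c ℤ.* f (suc i)) ℚ./ n) (filter (λ i → suc i ∣? g) (upTo g)))
    ≡⟨ ℚSum.sum-map-filter (λ i → suc i ∣? g) _ (upTo g) ⟩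
  sumℚ (map term (upTo g))
    ≡⟨ ℚSum.sum-upTo-truncate term (∣⇒≤ g∣B) beyond-g ⟨
  sumℚ (map term (upTo B)) ∎
  where
  open ≡-Reasoning
  term : ℕ → ℚ
  term i = if does (suc i ∣? g) then (c ℤ.* f (suc i)) ℚ./ n else 0ℚ
  instance
    g≢0 : NonZero g
    g≢0 = ≢-nonZero (λ g≡0 → ≢-nonZero⁻¹ B (0∣⇒≡0 (subst (_∣ B) g≡0 g∣B)))
  beyond-g : ∀ i → g ≤ i → term i ≡ 0ℚ
  beyond-g i g≤i = cong (λ b → if b then (c ℤ.* f (suc i)) ℚ./ n else 0ℚ)
    (dec-false (suc i ∣? g) (λ i+1∣g → <⇒≱ (s≤s g≤i) (∣⇒≤ i+1∣g)))

k<1+j/2⇔2k≤j : ∀ k j → k < suc (j / 2) ⇔ 2 * k ≤ j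
k<1+j/2⇔2k≤j k j = mk⇔
  (λ { (s≤s k≤j/2) → ≤-trans (*-monoʳ-≤ 2 k≤j/2)
                              (≤-trans (≤-reflexive (*-comm 2 (j / 2))) (m/n*n≤m j 2)) })
  (λ 2k≤j → s≤s (subst (_≤ j / 2) (m*n/n≡m k 2) (/-monoˡ-≤ 2 (subst (_≤ j) (*-comm 2 k) 2k≤j))))

k*d<1+qd/2⇔k<1+q/2 : ∀ k q d .{{_ : NonZero d}} → k * d < suc (q * d / 2) ⇔ k < suc (q / 2)
k*d<1+qd/2⇔k<1+q/2 k q d = mk⇔
  (λ k*d<1+qd/2 → from (k<1+j/2⇔2k≤j k q)
     (*-cancelʳ-≤ (2 * k) q d (subst (_≤ q * d) (sym (*-assoc 2 k d))
                                 (to (k<1+j/2⇔2k≤j (k * d) (q * d)) k*d<1+qd/2))))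
  (λ k<1+q/2 → from (k<1+j/2⇔2k≤j (k * d) (q * d))
     (subst (_≤ q * d) (*-assoc 2 k d) (*-monoˡ-≤ d (to (k<1+j/2⇔2k≤j k q) k<1+q/2))))
  where open Equivalence

module DivisorSumExpansion (r₀ j : ℕ) (c : ℤ) (w : (d : ℕ) → .{{NonZero d}} → ℤ) where
  open Equivalence

  r J : ℕ
  r = suc r₀
  J = suc (j / 2)

  g size : ℕ → ℕ
  g k = gcd (gcd r k) (j ∸ 2 * k)
  size k = r + k + (j ∸ 2 * k)

  convTerm : (d : ℕ) → .{{NonZero d}} → ℤ
  convTerm d = w d ℤ.* + convF (r / d) (j / d)

  wordTerm : ℕ → (d : ℕ) → .{{NonZero d}} → ℤ
  wordTerm k d = w d ℤ.* + multinom (r / d) (k / d) ((j ∸ 2 * k) / d)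

  wordFraction : ℕ → (d : ℕ) → .{{NonZero d}} → ℚ
  wordFraction k d = (c ℤ.* wordTerm k d) ℚ./ size k

  ∣g⇔ : ∀ {d k} → k < J → d ∣ g k ⇔ (d ∣ gcd r j × d ∣ k)
  ∣g⇔ {d} {k} k<J = mk⇔
    (λ d∣g → let d∣rk = ∣-trans d∣g (gcd[m,n]∣m (gcd r k) _)
                 d∣k = ∣-trans d∣rk (gcd[m,n]∣n r k)
                 d∣j = ∣m∸n∣n⇒∣m d 2k≤j (∣-trans d∣g (gcd[m,n]∣n (gcd r k) _)) (∣n⇒∣m*n 2 d∣k)
             in gcd-greatest (∣-trans d∣rk (gcd[m,n]∣m r k)) d∣j , d∣k)
    (λ { (d∣rj , d∣k) →
      gcd-greatest (gcd-greatest (∣-trans d∣rj (gcd[m,n]∣m r j)) d∣k)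
        (∣m+n∣m⇒∣n (subst (d ∣_) (sym (m+[n∸m]≡n 2k≤j)) (∣-trans d∣rj (gcd[m,n]∣n r j)))
                   (∣n⇒∣m*n 2 d∣k)) })
    where
    2k≤j : 2 * k ≤ j
    2k≤j = to (k<1+j/2⇔2k≤j k j) k<J

  multiples-contribution : ∀ d .{{_ : NonZero d}} → d ∣ gcd r j →
    (c ℤ.* convTerm d) ℚ./ r ≡
    sumℚ (map (λ k → if does (d ∣? g k) then wordFraction k d else 0ℚ) (upTo J))
  multiples-contribution d d∣rj = begin
    (c ℤ.* (w d ℤ.* + convF q p)) ℚ./ r
      ≡⟨ cong (λ x → (c ℤ.* (w d ℤ.* + x)) ℚ./ r) (convF-multinom q p) ⟩
    (c ℤ.* (w d ℤ.* + sum (map N′ (upTo J′)))) ℚ./ r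
      ≡⟨ cong (λ z → (c ℤ.* z) ℚ./ r) (*-pos-sum (w d) N′ (upTo J′)) ⟩
    (c ℤ.* sumℤ (map (λ k → w d ℤ.* + N′ k) (upTo J′))) ℚ./ r
      ≡⟨ *-sum-/ c r (λ k → w d ℤ.* + N′ k) (upTo J′) ⟩
    sumℚ (map (λ k → (c ℤ.* (w d ℤ.* + N′ k)) ℚ./ r) (upTo J′))
      ≡⟨ cong sumℚ (map-cong (λ k → sym (wordFraction-multiple k)) (upTo J′)) ⟩
    sumℚ (map (λ k → wordFraction (k * d) d) (upTo J′))
      ≡⟨ ℚSum.sum-upTo-divisible d (λ k → wordFraction k d) multiple<J⇔ ⟨
    sumℚ (map (λ k → if does (d ∣? k) then wordFraction k d else 0ℚ) (upTo J))
      ≡⟨ cong sumℚ (map-cong-upTo J (λ k k<J → cong (λ b → if b then wordFraction k d else 0ℚ)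
                                                   (does-⇔ (∣⇔∣g k<J) (d ∣? k) (d ∣? g k)))) ⟩
    sumℚ (map (λ k → if does (d ∣? g k) then wordFraction k d else 0ℚ) (upTo J)) ∎
    where
    open ≡-Reasoning
    d∣r : d ∣ r
    d∣r = ∣-trans d∣rj (gcd[m,n]∣m r j)
    d∣j : d ∣ j
    d∣j = ∣-trans d∣rj (gcd[m,n]∣n r j)
    q p J′ : ℕ
    q = r / d
    p = j / d
    J′ = suc (p / 2)
    instance
      q≢0 : NonZero q
      q≢0 = >-nonZero (m≥n⇒m/n>0 (∣⇒≤ d∣r))
    N′ : ℕ → ℕ
    N′ k = multinom (pred q) k (p ∸ 2 * k)
    ∣⇔∣g : ∀ {k} → k < J → d ∣ k ⇔ d ∣ g k
    ∣⇔∣g k<J = mk⇔ (λ d∣k → from (∣g⇔ k<J) (d∣rj , d∣k)) (proj₂ ∘ to (∣g⇔ k<J))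
    multiple<J⇔ : ∀ k → k * d < J ⇔ k < J′
    multiple<J⇔ k =
      subst (λ x → k * d < suc (x / 2) ⇔ k < J′) (m/n*n≡m d∣j) (k*d<1+qd/2⇔k<1+q/2 k p d)
    -- multinom q k m / ((q + k + m) d) = multinom (q − 1) k m / (q d)
    wordFraction-multiple : ∀ k → wordFraction (k * d) d ≡ (c ℤ.* (w d ℤ.* + N′ k)) ℚ./ r
    wordFraction-multiple k = begin
      (c ℤ.* (w d ℤ.* + multinom q (k * d / d) ((j ∸ 2 * (k * d)) / d))) ℚ./ size (k * d)
        ≡⟨ cong₂ (λ a b → (c ℤ.* (w d ℤ.* + multinom q a b)) ℚ./ size (k * d))
                 (m*n/n≡m k d) (trans (/-congˡ j∸2kd≡md) (m*n/n≡m m d)) ⟩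
      (c ℤ.* (w d ℤ.* + multinom q k m)) ℚ./ size (k * d)
        ≡⟨ cong (λ z → z ℚ./ size (k * d)) (ℤP.*-assoc c (w d) _) ⟨
      (c ℤ.* w d ℤ.* + multinom q k m) ℚ./ size (k * d)
        ≡⟨ /-scale (c ℤ.* w d) _ _ (size (k * d)) r rescaled ⟩
      (c ℤ.* w d ℤ.* + N′ k) ℚ./ r
        ≡⟨ cong (λ z → z ℚ./ r) (ℤP.*-assoc c (w d) _) ⟩
      (c ℤ.* (w d ℤ.* + N′ k)) ℚ./ r ∎
      where
      m = p ∸ 2 * k
      j∸2kd≡md : j ∸ 2 * (k * d) ≡ m * d
      j∸2kd≡md =
        sym (trans (*-distribʳ-∸ d p (2 * k)) (cong₂ _∸_ (m/n*n≡m d∣j) (*-assoc 2 k d)))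
      size≡ : size (k * d) ≡ (q + k + m) * d
      size≡ = trans (cong₂ (λ x y → x + k * d + y) (sym (m/n*n≡m d∣r)) j∸2kd≡md) (factor q k m d)
        where
        factor : ∀ x y z u → x * u + y * u + z * u ≡ (x + y + z) * u
        factor = solve-∀
      rescaled : multinom q k m * r ≡ N′ k * size (k * d)
      rescaled = begin
        multinom q k m * r             ≡⟨ cong (multinom q k m *_) (m/n*n≡m d∣r) ⟨
        multinom q k m * (q * d)       ≡⟨ *-assoc (multinom q k m) q d ⟨
        multinom q k m * q * d         ≡⟨ cong (_* d) (multinom-pred₁ q k m) ⟩
        (q + k + m) * N′ k * d         ≡⟨ cong (_* d) (*-comm (q + k + m) (N′ k)) ⟩
        N′ k * (q + k + m) * d         ≡⟨ *-assoc (N′ k) (q + k + m) d ⟩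
        N′ k * ((q + k + m) * d)       ≡⟨ cong (N′ k *_) size≡ ⟨
        N′ k * size (k * d)            ∎

  divisor-contribution : ∀ d .{{_ : NonZero d}} →
    (if does (d ∣? gcd r j) then (c ℤ.* convTerm d) ℚ./ r else 0ℚ) ≡
    sumℚ (map (λ k → if does (d ∣? g k) then wordFraction k d else 0ℚ) (upTo J))
  divisor-contribution d = by-cases (d ∣? gcd r j)
    where
    by-cases : (d∣?rj : Dec (d ∣ gcd r j)) →
      (if does d∣?rj then (c ℤ.* convTerm d) ℚ./ r else 0ℚ) ≡
      sumℚ (map (λ k → if does (d ∣? g k) then wordFraction k d else 0ℚ) (upTo J))
    by-cases (yes d∣rj) = multiples-contribution d d∣rj
    by-cases (no d∤rj) = sym (ℚSum.sum-upTo-ε _ J (λ k k<J →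
      cong (λ b → if b then wordFraction k d else 0ℚ) (dec-false (d ∣? g k) (d∤rj ∘ proj₁ ∘ to (∣g⇔ k<J)))))

  expansion : (c ℤ.* sumDiv (gcd r j) convTerm) ℚ./ r ≡
    sumℚ (map (λ k → over (c ℤ.* sumDiv (g k) (wordTerm k)) (size k)) (upTo J))
  expansion = begin
    (c ℤ.* sumDiv (gcd r j) convTerm) ℚ./ r
      ≡⟨ sumDiv-/ c r r convTerm (gcd[m,n]∣m r j) ⟩
    sumℚ (map (λ i → if does (suc i ∣? gcd r j) then (c ℤ.* convTerm (suc i)) ℚ./ r else 0ℚ)
              (upTo r))
      ≡⟨ cong sumℚ (map-cong (λ i → divisor-contribution (suc i)) (upTo r)) ⟩
    sumℚ (map (λ i → sumℚ (map (term i) (upTo J))) (upTo r))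
      ≡⟨ ℚSum.sum-swap term (upTo r) (upTo J) ⟩
    sumℚ (map (λ k → sumℚ (map (λ i → term i k) (upTo r))) (upTo J))
      ≡⟨ cong sumℚ (map-cong (λ k → sumDiv-/ c r (size k) (wordTerm k) (g∣r k)) (upTo J)) ⟨
    sumℚ (map (λ k → (c ℤ.* sumDiv (g k) (wordTerm k)) ℚ./ size k) (upTo J)) ∎
    where
    open ≡-Reasoning
    term : ℕ → ℕ → ℚ
    term i k = if does (suc i ∣? g k) then wordFraction k (suc i) else 0ℚ
    g∣r : ∀ k → g k ∣ r
    g∣r k = ∣-trans (gcd[m,n]∣m (gcd r k) _) (gcd[m,n]∣m r k)

theorem8 : (r j : ℕ) → .{{_ : NonZero r}} →
    (G r j ≡ sumℚ (map (λ k → M r k (j ∸ 2 * k)) (upTo (suc (j / 2)))))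
    × (H r j ≡ sumℚ (map (λ k → V₁ r k (j ∸ 2 * k)) (upTo (suc (j / 2)))))
theorem8 (suc r) j =
  G-expansion , DivisorSumExpansion.expansion r j (sgn (suc r)) (λ d → μ d ℤ.* sgn (suc r / d))
  where
  open ≡-Reasoning
  open DivisorSumExpansion r j (+ 1) (λ d → μ d) using (expansion; g; size; wordTerm; convTerm)
  G-expansion : G (suc r) j ≡ sumℚ (map (λ k → M (suc r) k (j ∸ 2 * k)) (upTo (suc (j / 2))))
  G-expansion = begin
    G (suc r) j
      ≡⟨ cong (λ z → z ℚ./ suc r) (ℤP.*-identityˡ (sumDiv (gcd (suc r) j) convTerm)) ⟨
    (+ 1 ℤ.* sumDiv (gcd (suc r) j) convTerm) ℚ./ suc r
      ≡⟨ expansion ⟩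
    sumℚ (map (λ k → over (+ 1 ℤ.* sumDiv (g k) (wordTerm k)) (size k)) (upTo (suc (j / 2))))
      ≡⟨ cong sumℚ (map-cong (λ k → cong (λ z → over z (size k)) (ℤP.*-identityˡ (sumDiv (g k) (wordTerm k))))
                   (upTo (suc (j / 2)))) ⟩
    sumℚ (map (λ k → M (suc r) k (j ∸ 2 * k)) (upTo (suc (j / 2)))) ∎
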